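{- Let $n\ge2$ with prime factorization $n=p_1^{\alpha_1}\cdots p_k^{\alpha_k}$, and let $n_*=p_1^{\lfloor\alpha_1/2\rfloor}\cdots p_k^{\lfloor\alpha_k/2\rfloor}$. For a divisor $a$ of $n$ write $T_a=\{x\in\mathbb{Z}_n\setminus\{0\}:\gcd(x,n)=a\}$. A vertex $v$ of $\Gamma(\mathbb{Z}_n)$ is a simplicial vertex if and only if $v\in T_2$ or $v\in T_g$ for some divisor $g$ of $n_*$.
   Context: For a commutative ring $R$ with identity, the zero-divisor graph $\Gamma(R)$ is the simple undirected graph whose vertices are the nonzero zero-divisors of $R$, two distinct vertices $u,v$ being adjacent iff $uv=0$. A vertex is simplicial if its neighbors are pairwise adjacent. -}

module Defs where

open import Data.Nat using (ℕ; zero; suc; _*_; _^_; _<_; ⌊_/2⌋)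
open import Data.Nat.Divisibility using (_∣_; _∣?_; divides)
open import Data.Nat.GCD using (gcd)
open import Data.Nat.Primality using (prime?)
open import Data.List using (List; map; upTo)
open import Data.Nat.ListAction using (product)
open import Data.Bool using (if_then_else_)
open import Data.Product using (_×_; Σ)
open import Relation.Nullary using (¬_; yes; no; does)
open import Relation.Binary.PropositionalEquality using (_≡_; _≢_)

-- Exponent of p in n, computed with fuel (fuel n suffices for p ≥ 2, n ≥ 1).
multiplicityF : ℕ → ℕ → ℕ → ℕ
multiplicityF zero    p m = 0
multiplicityF (suc f) p m with p ∣? m
... | yes (divides q _) = suc (multiplicityF f p q)
... | no _              = 0

multiplicity : ℕ → ℕ → ℕ
multiplicity p n = multiplicityF n p n

-- n_* = ∏_{p prime, p ∣ n} p ^ ⌊α_p(n)/2⌋   (primes p ≤ n; others contribute p^0 = 1)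
nStar : ℕ → ℕ
nStar n = product (map (λ p → if does (prime? p) then p ^ ⌊ multiplicity p n /2⌋ else 1) (upTo (suc n)))

-- Elements of ℤ_n are represented by naturals x < n; x·y = 0 in ℤ_n iff n ∣ x*y.
-- Vertices of Γ(ℤ_n): nonzero zero-divisors.
IsVertex : ℕ → ℕ → Set
IsVertex n x = x < n × x ≢ 0 × Σ ℕ (λ y → y < n × y ≢ 0 × n ∣ x * y)

Adj : ℕ → ℕ → ℕ → Set
Adj n u v = IsVertex n u × IsVertex n v × u ≢ v × n ∣ u * v

IsSimplicial : ℕ → ℕ → Set
IsSimplicial n v = ∀ u w → Adj n v u → Adj n v w → u ≢ w → Adj n u w

T : ℕ → ℕ → ℕ → Set
T n a x = x < n × x ≢ 0 × gcd x n ≡ a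

-- Write g = gcd v n and n = m g. In ℤ_n the neighbours of v are the nonzero
-- multiples of m. If g = 2 there is only one, m, so v is simplicial vacuously;
-- if g² ∣ n then g ∣ m, so any two multiples of m multiply to 0. Otherwise g ≥ 3
-- and m, (g - 1) m are two distinct neighbours whose product vanishes only if
-- g ∣ m. Finally g² ∣ n iff g ∣ n_*, as the divisors of n_* are the d with d² ∣ n.
module Submission where

open import Defs
open import Data.Nat
open import Data.Nat.Properties
open import Data.Nat.Divisibility
open import Data.Nat.DivMod using (m/n*n≡m)
open import Data.Nat.GCD using (gcd; gcd[m,n]∣m; gcd[m,n]∣n; gcd[m,n]≢0; gcd-zeroˡ)
open import Data.Nat.Coprimality as Coprimality using (Coprime; coprime-/gcd; coprime-divisor; coprime-+; gcd≡1⇒coprime)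
open import Data.Nat.Primality using (Prime; prime?; euclidsLemma; prime⇒nonZero; prime⇒nonTrivial)
open import Data.Nat.Primality.Factorisation using (factorise)
open import Data.Nat.Tactic.RingSolver using (solve-∀)
open import Data.List using ([]; _∷_; _++_; map; upTo; [_])
open import Data.List.Properties using (map-++; upTo-∷ʳ)
open import Data.List.Relation.Unary.All using (_∷_)
open import Data.Nat.ListAction using (product)
open import Data.Nat.ListAction.Properties using (product-++)
open import Data.Bool using (if_then_else_)
open import Data.Product using (Σ; _×_; _,_; proj₁; proj₂)
open import Data.Sum using (_⊎_; inj₁; inj₂)
open import Relation.Nullary using (¬_; Dec; yes; no; does; contradiction)
open import Relation.Binary.PropositionalEquality hiding ([_])
open import Function.Bundles using (_⇔_; mk⇔; Equivalence)
open import Function.Base using (_∘_; it)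

prime⇒2≤ : ∀ {p} → Prime p → 2 ≤ p
prime⇒2≤ {p} pp = nonTrivial⇒n>1 p {{prime⇒nonTrivial pp}}

prime∤1 : ∀ {p} → Prime p → ¬ p ∣ 1
prime∤1 pp p∣1 = <⇒≢ (prime⇒2≤ pp) (sym (∣1⇒≡1 p∣1))

prime∣^⇒∣ : ∀ {p q} → Prime p → ∀ k → p ∣ q ^ k → p ∣ q
prime∣^⇒∣ pp zero p∣1 = contradiction p∣1 (prime∤1 pp)
prime∣^⇒∣ {q = q} pp (suc k) p∣q^sk with euclidsLemma q (q ^ k) pp p∣q^sk
... | inj₁ p∣q   = p∣q
... | inj₂ p∣q^k = prime∣^⇒∣ pp k p∣q^k

prime^∣*⇒∣ : ∀ {p a} → Prime p → ¬ p ∣ a → ∀ k b → p ^ k ∣ a * b → p ^ k ∣ b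
prime^∣*⇒∣ pp p∤a zero b _ = 1∣ b
prime^∣*⇒∣ {p} {a} pp p∤a (suc k) b p^sk∣ab with euclidsLemma a b pp (∣-trans (m∣m*n (p ^ k)) p^sk∣ab)
... | inj₁ p∣a = contradiction p∣a p∤a
... | inj₂ (divides c refl) = subst (p * p ^ k ∣_) (*-comm p c) (*-monoʳ-∣ p (prime^∣*⇒∣ pp p∤a k c p^k∣ac))
  where
  instance _ = prime⇒nonZero pp
  p^k∣ac : p ^ k ∣ a * c
  p^k∣ac = *-cancelˡ-∣ p (subst (p * p ^ k ∣_) (trans (sym (*-assoc a c p)) (*-comm (a * c) p)) p^sk∣ab)

^-mono-∣ : ∀ p {j k} → j ≤ k → p ^ j ∣ p ^ k
^-mono-∣ p {j} {k} j≤k = divides (p ^ (k ∸ j)) (begin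
    p ^ k                 ≡⟨ cong (p ^_) (sym (m+[n∸m]≡n j≤k)) ⟩
    p ^ (j + (k ∸ j))     ≡⟨ ^-distribˡ-+-* p j (k ∸ j) ⟩
    p ^ j * p ^ (k ∸ j)   ≡⟨ *-comm (p ^ j) _ ⟩
    p ^ (k ∸ j) * p ^ j   ∎)
  where open ≡-Reasoning

⌊n/2⌋+⌊n/2⌋≤n : ∀ n → ⌊ n /2⌋ + ⌊ n /2⌋ ≤ n
⌊n/2⌋+⌊n/2⌋≤n n = ≤-trans (+-monoʳ-≤ ⌊ n /2⌋ (⌊n/2⌋≤⌈n/2⌉ n)) (≤-reflexive (⌊n/2⌋+⌈n/2⌉≡n n))

m+m≤n⇒m≤⌊n/2⌋ : ∀ {m n} → m + m ≤ n → m ≤ ⌊ n /2⌋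
m+m≤n⇒m≤⌊n/2⌋ {m} m+m≤n = subst (_≤ _) (sym (n≡⌊n+n/2⌋ m)) (⌊n/2⌋-mono m+m≤n)

multiplicityF-∣ : ∀ f p m → p ^ multiplicityF f p m ∣ m
multiplicityF-∣ zero    p m = 1∣ m
multiplicityF-∣ (suc f) p m with p ∣? m
... | yes (divides q refl) = subst (p * p ^ multiplicityF f p q ∣_) (*-comm p q) (*-monoʳ-∣ p (multiplicityF-∣ f p q))
... | no _ = 1∣ m

-- The fuel f bounds m, and each division by p strictly decreases m.
^∣⇒≤multiplicityF : ∀ {p} → 2 ≤ p → ∀ f m → .{{NonZero m}} → m ≤ f → ∀ k → p ^ k ∣ m → k ≤ multiplicityF f p m
^∣⇒≤multiplicityF 2≤p f       m m≤f zero    _ = z≤n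
^∣⇒≤multiplicityF 2≤p zero    (suc m) () (suc k) _
^∣⇒≤multiplicityF {p} 2≤p (suc f) m m≤f (suc k) p^sk∣m with p ∣? m
... | no p∤m = contradiction (∣-trans (n∣m*n (p ^ k)) (subst (_∣ m) (*-comm p (p ^ k)) p^sk∣m)) p∤m
... | yes (divides q refl) = s≤s (^∣⇒≤multiplicityF 2≤p f q q≤f k p^k∣q)
  where
  instance
    _ : NonZero p
    _ = >-nonZero (≤-trans (s≤s z≤n) 2≤p)
    _ : NonZero q
    _ = m*n≢0⇒m≢0 q
  q≤f : q ≤ f
  q≤f = ≤-pred (≤-trans (m<m*n q p 2≤p) m≤f)
  p^k∣q : p ^ k ∣ q
  p^k∣q = *-cancelˡ-∣ p (subst (p * p ^ k ∣_) (*-comm q p) p^sk∣m)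

^multiplicity∣ : ∀ p m → p ^ multiplicity p m ∣ m
^multiplicity∣ p m = multiplicityF-∣ m p m

^∣⇒≤multiplicity : ∀ {p m k} → 2 ≤ p → .{{NonZero m}} → p ^ k ∣ m → k ≤ multiplicity p m
^∣⇒≤multiplicity {m = m} {k} 2≤p = ^∣⇒≤multiplicityF 2≤p m m ≤-refl k

multiplicity-split : ∀ {p m} → 2 ≤ p → .{{NonZero m}} →
  Σ ℕ λ r → m ≡ p ^ multiplicity p m * r × ¬ p ∣ r
multiplicity-split {p} {m} 2≤p with ^multiplicity∣ p m
... | divides r m≡r*p^α = r , trans m≡r*p^α (*-comm r _) , p∤r
  where
  p∤r : ¬ p ∣ r
  p∤r p∣r = 1+n≰n (^∣⇒≤multiplicity 2≤p p^[1+α]∣m)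
    where
    p^[1+α]∣m : p ^ suc (multiplicity p m) ∣ m
    p^[1+α]∣m = subst (p ^ suc (multiplicity p m) ∣_) (sym m≡r*p^α) (*-monoˡ-∣ (p ^ multiplicity p m) p∣r)

primePowerFactor : (ℕ → ℕ) → ℕ → ℕ
primePowerFactor e p = if does (prime? p) then p ^ e p else 1

-- ∏_{p < N, p prime} p ^ e p; nStar n is definitionally
-- primePowerProduct (λ p → ⌊ multiplicity p n /2⌋) (suc n).
primePowerProduct : (ℕ → ℕ) → ℕ → ℕ
primePowerProduct e N = product (map (primePowerFactor e) (upTo N))

primePowerProduct-suc : ∀ e N → primePowerProduct e (suc N) ≡ primePowerProduct e N * primePowerFactor e N
primePowerProduct-suc e N = begin
    product (map f (upTo (suc N)))      ≡⟨ cong (product ∘ map f) (sym (upTo-∷ʳ N)) ⟩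
    product (map f (upTo N ++ [ N ]))   ≡⟨ cong product (map-++ f (upTo N) [ N ]) ⟩
    product (map f (upTo N) ++ [ f N ]) ≡⟨ product-++ (map f (upTo N)) [ f N ] ⟩
    primePowerProduct e N * (f N * 1)   ≡⟨ cong (primePowerProduct e N *_) (*-identityʳ (f N)) ⟩
    primePowerProduct e N * f N         ∎
  where
  open ≡-Reasoning
  f = primePowerFactor e

primePowerProduct-+ : ∀ e f N → primePowerProduct e N * primePowerProduct f N ≡ primePowerProduct (λ p → e p + f p) N
primePowerProduct-+ e f zero = refl
primePowerProduct-+ e f (suc N) = begin
    P e (suc N) * P f (suc N)     ≡⟨ cong₂ _*_ (primePowerProduct-suc e N) (primePowerProduct-suc f N) ⟩
    (P e N * F e) * (P f N * F f) ≡⟨ [m*n]*[o*p]≡[m*o]*[n*p] (P e N) (F e) (P f N) (F f) ⟩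
    (P e N * P f N) * (F e * F f) ≡⟨ cong₂ _*_ (primePowerProduct-+ e f N) factor-+ ⟩
    P e+f N * F e+f               ≡⟨ primePowerProduct-suc e+f N ⟨
    P e+f (suc N)                 ∎
  where
  open ≡-Reasoning
  P = primePowerProduct
  F = λ e → primePowerFactor e N
  e+f = λ p → e p + f p
  factor-+ : F e * F f ≡ F e+f
  factor-+ with prime? N
  ... | yes _ = sym (^-distribˡ-+-* N (e N) (f N))
  ... | no _  = refl

prime∤primePowerProduct : ∀ {p} → Prime p → ∀ e N → N ≤ p → ¬ p ∣ primePowerProduct e N
prime∤primePowerProduct pp e zero    _ p∣1 = prime∤1 pp p∣1
prime∤primePowerProduct {p} pp e (suc N) N<p p∣P
  with prime? N | euclidsLemma (primePowerProduct e N) _ pp (subst (p ∣_) (primePowerProduct-suc e N) p∣P)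
... | _      | inj₁ p∣P' = prime∤primePowerProduct pp e N (<⇒≤ N<p) p∣P'
... | no _   | inj₂ p∣1  = prime∤1 pp p∣1
... | yes pN | inj₂ p∣N^ = <⇒≱ N<p (∣⇒≤ {{prime⇒nonZero pN}} (prime∣^⇒∣ pp (e N) p∣N^))

primePowerProduct-∣ : ∀ e N {x} → (∀ p → Prime p → p < N → p ^ e p ∣ x) → primePowerProduct e N ∣ x
primePowerProduct-∣ e zero    {x} _      = 1∣ x
primePowerProduct-∣ e (suc N) {x} p^e∣x =
  subst (_∣ x) (sym (primePowerProduct-suc e N)) (step (prime? N))
  where
  P∣x : primePowerProduct e N ∣ x
  P∣x = primePowerProduct-∣ e N (λ p pp p<N → p^e∣x p pp (m<n⇒m<1+n p<N))
  step : (pN? : Dec (Prime N)) → primePowerProduct e N * (if does pN? then N ^ e N else 1) ∣ x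
  step (no _)   = subst (_∣ x) (sym (*-identityʳ _)) P∣x
  step (yes pN) with P∣x
  ... | divides q refl = subst (P * N ^ e N ∣_) (*-comm P q) (*-monoʳ-∣ P N^e∣q)
    where
    P = primePowerProduct e N
    N^e∣q : N ^ e N ∣ q
    N^e∣q = prime^∣*⇒∣ pN (prime∤primePowerProduct pN e N ≤-refl) (e N) q
              (subst (N ^ e N ∣_) (*-comm q P) (p^e∣x N pN ≤-refl))

primeFactorFree⇒≡1 : ∀ {d} → .{{NonZero d}} → (∀ p → Prime p → ¬ p ∣ d) → d ≡ 1
primeFactorFree⇒≡1 {d} free with factorise d
... | record { factors = [] ; isFactorisation = d≡1 } = d≡1
... | record { factors = p ∷ ps ; isFactorisation = d≡p*ps ; factorsPrime = pp ∷ _ } =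
  contradiction (subst (p ∣_) (sym d≡p*ps) (m∣m*n _)) (free p pp)

∣primePowerProduct : ∀ e N {d} → .{{NonZero d}} →
  (∀ p → Prime p → p ∣ d → p < N) → (∀ p k → Prime p → p ^ k ∣ d → k ≤ e p) →
  d ∣ primePowerProduct e N
∣primePowerProduct e zero {d} below _ =
  ∣-reflexive (primeFactorFree⇒≡1 (λ p pp p∣d → contradiction (below p pp p∣d) λ ()))
∣primePowerProduct e (suc N) {d} below bounded =
  subst (d ∣_) (sym (primePowerProduct-suc e N)) (step (prime? N))
  where
  step : (pN? : Dec (Prime N)) → d ∣ primePowerProduct e N * (if does pN? then N ^ e N else 1)
  step (no ¬pN) = subst (d ∣_) (sym (*-identityʳ _)) (∣primePowerProduct e N below′ bounded)
    where
    below′ : ∀ p → Prime p → p ∣ d → p < N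
    below′ p pp p∣d with m<1+n⇒m<n∨m≡n (below p pp p∣d)
    ... | inj₁ p<N = p<N
    ... | inj₂ refl = contradiction pp ¬pN
  step (yes pN) with multiplicity-split {N} {d} (prime⇒2≤ pN)
  ... | r , d≡N^k*r , N∤r = subst (_∣ _) (trans (*-comm r _) (sym d≡N^k*r)) (*-pres-∣ r∣P N^k∣N^e)
    where
    k = multiplicity N d
    r∣d : r ∣ d
    r∣d = subst (r ∣_) (sym d≡N^k*r) (n∣m*n (N ^ k))
    instance
      _ : NonZero r
      _ = m*n≢0⇒n≢0 (N ^ k) {{subst NonZero d≡N^k*r it}}
    below′ : ∀ p → Prime p → p ∣ r → p < N
    below′ p pp p∣r with m<1+n⇒m<n∨m≡n (below p pp (∣-trans p∣r r∣d))
    ... | inj₁ p<N = p<N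
    ... | inj₂ refl = contradiction p∣r N∤r
    r∣P : r ∣ primePowerProduct e N
    r∣P = ∣primePowerProduct e N below′ (λ p j pp p^j∣r → bounded p j pp (∣-trans p^j∣r r∣d))
    N^k∣N^e : N ^ k ∣ N ^ e N
    N^k∣N^e = ^-mono-∣ N (bounded N k pN (^multiplicity∣ N d))

nStar*nStar∣n : ∀ n → nStar n * nStar n ∣ n
nStar*nStar∣n n = subst (_∣ n) (sym (primePowerProduct-+ half half (suc n)))
  (primePowerProduct-∣ (λ p → half p + half p) (suc n) p^[h+h]∣n)
  where
  half = λ p → ⌊ multiplicity p n /2⌋
  p^[h+h]∣n : ∀ p → Prime p → p < suc n → p ^ (half p + half p) ∣ n
  p^[h+h]∣n p _ _ = ∣-trans (^-mono-∣ p (⌊n/2⌋+⌊n/2⌋≤n (multiplicity p n))) (^multiplicity∣ p n)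

∣nStar : ∀ {n d} → .{{NonZero n}} → d * d ∣ n → d ∣ nStar n
∣nStar {n} {zero} 0∣n = contradiction (0∣⇒≡0 0∣n) (≢-nonZero⁻¹ n)
∣nStar {n} {d@(suc _)} d²∣n = ∣primePowerProduct (λ p → ⌊ multiplicity p n /2⌋) (suc n) below bounded
  where
  d∣n : d ∣ n
  d∣n = ∣-trans (m∣m*n d) d²∣n
  below : ∀ p → Prime p → p ∣ d → p < suc n
  below p _ p∣d = s≤s (∣⇒≤ (∣-trans p∣d d∣n))
  bounded : ∀ p k → Prime p → p ^ k ∣ d → k ≤ ⌊ multiplicity p n /2⌋
  bounded p k pp p^k∣d = m+m≤n⇒m≤⌊n/2⌋ (^∣⇒≤multiplicity (prime⇒2≤ pp) p^[k+k]∣n)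
    where
    p^[k+k]∣n : p ^ (k + k) ∣ n
    p^[k+k]∣n = subst (_∣ n) (sym (^-distribˡ-+-* p k k)) (∣-trans (*-pres-∣ p^k∣d p^k∣d) d²∣n)

∣nStar⇔*∣ : ∀ {n d} → .{{NonZero n}} → d ∣ nStar n ⇔ d * d ∣ n
∣nStar⇔*∣ {n} = mk⇔ (λ d∣nStar → ∣-trans (*-pres-∣ d∣nStar d∣nStar) (nStar*nStar∣n n)) ∣nStar

gcd-nonZeroʳ : ∀ m n → .{{NonZero n}} → NonZero (gcd m n)
gcd-nonZeroʳ m n = ≢-nonZero (gcd[m,n]≢0 m n (inj₂ (≢-nonZero⁻¹ n)))

module Cofactor (n v : ℕ) .{{_ : NonZero n}} where

  g : ℕ
  g = gcd v n

  instance
    g≢0 : NonZero g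
    g≢0 = gcd-nonZeroʳ v n

  cofactor : ℕ
  cofactor = n / g

  n≡cofactor*g : n ≡ cofactor * g
  n≡cofactor*g = sym (m/n*n≡m (gcd[m,n]∣n v n))

  ∣*⇔cofactor∣ : ∀ u → n ∣ v * u ⇔ cofactor ∣ u
  ∣*⇔cofactor∣ u = mk⇔ to from
    where
    a = v / g
    m = cofactor
    v≡a*g : v ≡ a * g
    v≡a*g = sym (m/n*n≡m (gcd[m,n]∣m v n))
    to : n ∣ v * u → m ∣ u
    to n∣vu = coprime-divisor (Coprimality.sym (coprime-/gcd v n)) (*-cancelʳ-∣ g m*g∣a*u*g)
      where
      rearrange : ∀ a g u → a * g * u ≡ a * u * g
      rearrange = solve-∀
      m*g∣a*u*g : m * g ∣ a * u * g
      m*g∣a*u*g = subst₂ _∣_ n≡cofactor*g (trans (cong (_* u) v≡a*g) (rearrange a g u)) n∣vu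
    from : m ∣ u → n ∣ v * u
    from (divides k refl) = divides (a * k) (begin
        v * (k * m)       ≡⟨ cong (_* (k * m)) v≡a*g ⟩
        a * g * (k * m)   ≡⟨ rearrange a g k m ⟩
        a * k * (m * g)   ≡⟨ cong (a * k *_) n≡cofactor*g ⟨
        a * k * n         ∎)
      where
      open ≡-Reasoning
      rearrange : ∀ a g k m → a * g * (k * m) ≡ a * k * (m * g)
      rearrange = solve-∀

module Vertex {n v : ℕ} (vertex : IsVertex n v) where

  private
    v<n = proj₁ vertex
    v≢0 = proj₁ (proj₂ vertex)

  instance
    n≢0 : NonZero n
    n≢0 = ≢-nonZero (m<n⇒n≢0 v<n)

  open Cofactor n v public

  private
    m = cofactor
    instance
      m≢0 : NonZero m
      m≢0 = m*n≢0⇒m≢0 m {{subst NonZero n≡cofactor*g n≢0}}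

  gcd≢1 : g ≢ 1
  gcd≢1 g≡1 with proj₂ (proj₂ vertex)
  ... | y , y<n , y≢0 , n∣vy = <⇒≱ y<n (∣⇒≤ {{≢-nonZero y≢0}} (subst (_∣ y) (sym n≡m) m∣y))
    where
    m∣y : m ∣ y
    m∣y = Equivalence.to (∣*⇔cofactor∣ y) n∣vy
    n≡m : n ≡ m
    n≡m = trans n≡cofactor*g (trans (cong (m *_) g≡1) (*-identityʳ m))

  2≤gcd : 2 ≤ g
  2≤gcd = ≤∧≢⇒< (n≢0⇒n>0 (≢-nonZero⁻¹ g)) (gcd≢1 ∘ sym)

  cofactor-multiple-isVertex : ∀ k → .{{NonZero k}} → k < g → IsVertex n (k * m)
  cofactor-multiple-isVertex k k<g =
    subst (k * m <_) (sym (trans n≡cofactor*g (*-comm m g))) (*-monoˡ-< m k<g) ,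
    ≢-nonZero⁻¹ (k * m) {{m*n≢0 k m}} ,
    v , v<n , v≢0 , subst (n ∣_) (*-comm v (k * m)) (Equivalence.from (∣*⇔cofactor∣ (k * m)) (n∣m*n k))

  cofactor-multiple-self⊎adjacent : ∀ k → .{{NonZero k}} → k < g → v ≡ k * m ⊎ Adj n v (k * m)
  cofactor-multiple-self⊎adjacent k k<g with v ≟ k * m
  ... | yes v≡km = inj₁ v≡km
  ... | no v≢km  = inj₂ (vertex , cofactor-multiple-isVertex k k<g , v≢km ,
                          Equivalence.from (∣*⇔cofactor∣ (k * m)) (n∣m*n k))

  gcd≡2⇒simplicial : g ≡ 2 → IsSimplicial n v
  gcd≡2⇒simplicial g≡2 u w v~u v~w u≢w =
    contradiction (trans (neighbour≡cofactor v~u) (sym (neighbour≡cofactor v~w))) u≢w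
    where
    neighbour≡cofactor : ∀ {u} → Adj n v u → u ≡ m
    neighbour≡cofactor (_ , (u<n , u≢0 , _) , _ , n∣vu) with Equivalence.to (∣*⇔cofactor∣ _) n∣vu
    ... | divides k refl = trans (cong (_* m) (k≡1 k u≢0 (*-cancelʳ-< m k 2 k*m<2*m))) (*-identityˡ m)
      where
      k*m<2*m : k * m < 2 * m
      k*m<2*m = subst (k * m <_) (trans n≡cofactor*g (trans (cong (m *_) g≡2) (*-comm m 2))) u<n
      k≡1 : ∀ k → k * m ≢ 0 → k < 2 → k ≡ 1
      k≡1 zero          0≢0 _ = contradiction refl 0≢0
      k≡1 (suc zero)    _   _ = refl
      k≡1 (suc (suc _)) _   (s≤s (s≤s ()))

  gcd*gcd∣⇒simplicial : g * g ∣ n → IsSimplicial n v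
  gcd*gcd∣⇒simplicial g*g∣n u w (_ , u-vertex , _ , n∣vu) (_ , w-vertex , _ , n∣vw) u≢w =
    u-vertex , w-vertex , u≢w , ∣-trans n∣m*m (*-pres-∣ (annihilated n∣vu) (annihilated n∣vw))
    where
    annihilated : ∀ {x} → n ∣ v * x → m ∣ x
    annihilated = Equivalence.to (∣*⇔cofactor∣ _)
    g∣m : g ∣ m
    g∣m = *-cancelʳ-∣ g (subst (g * g ∣_) n≡cofactor*g g*g∣n)
    n∣m*m : n ∣ m * m
    n∣m*m = subst (_∣ m * m) (sym n≡cofactor*g) (*-monoʳ-∣ m g∣m)

  -- The test vertices are the neighbours cofactor and (g - 1) * cofactor of v:
  -- adjacency forces g ∣ (g - 1) * cofactor, and g is coprime to g - 1.
  simplicial⇒gcd*gcd∣ : IsSimplicial n v → g ≢ 2 → g * g ∣ n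
  simplicial⇒gcd*gcd∣ simplicial g≢2 = subst (g * g ∣_) (sym n≡cofactor*g) (*-monoˡ-∣ g g∣m)
    where
    h = pred g
    2≤h : 2 ≤ h
    2≤h = pred-mono-≤ (≤∧≢⇒< 2≤gcd (g≢2 ∘ sym))
    instance
      h≢0 : NonZero h
      h≢0 = >-nonZero (≤-trans (s≤s z≤n) 2≤h)
    g≡1+h : g ≡ suc h
    g≡1+h = sym (suc-pred g)
    1<g : 1 < g
    1<g = 2≤gcd
    h<g : h < g
    h<g = subst (h <_) (sym g≡1+h) (n<1+n h)
    g-coprime-h : Coprime g h
    g-coprime-h = subst (λ x → Coprime x h) (trans (+-comm h 1) (sym g≡1+h))
                    (coprime-+ (gcd≡1⇒coprime (gcd-zeroˡ h)))
    g∣v : g ∣ v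
    g∣v = gcd[m,n]∣m v n
    m≢h*m : 1 * m ≢ h * m
    m≢h*m m≡h*m = <⇒≢ 2≤h (*-cancelʳ-≡ 1 h m m≡h*m)
    g∣m : g ∣ m
    g∣m with cofactor-multiple-self⊎adjacent 1 1<g | cofactor-multiple-self⊎adjacent h h<g
    ... | inj₁ v≡m   | _          = subst (g ∣_) (trans v≡m (*-identityˡ m)) g∣v
    ... | _          | inj₁ v≡h*m = coprime-divisor g-coprime-h (subst (g ∣_) v≡h*m g∣v)
    ... | inj₂ v~m   | inj₂ v~h*m = coprime-divisor g-coprime-h (*-cancelˡ-∣ m m*g∣m*[h*m])
      where
      m*g∣m*[h*m] : m * g ∣ m * (h * m)
      m*g∣m*[h*m] = subst₂ _∣_ n≡cofactor*g (cong (_* (h * m)) (*-identityˡ m))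
                      (proj₂ (proj₂ (proj₂ (simplicial (1 * m) (h * m) v~m v~h*m m≢h*m))))

lemma2p18 : (n : ℕ) → 2 ≤ n → (v : ℕ) → IsVertex n v →
    (IsSimplicial n v ⇔ (T n 2 v ⊎ Σ ℕ (λ g → g ∣ nStar n × T n g v)))
-- The hypothesis 2 ≤ n is implied by IsVertex n v.
lemma2p18 n _ v vertex = mk⇔ to from
  where
  open Vertex vertex
  to : IsSimplicial n v → T n 2 v ⊎ Σ ℕ (λ d → d ∣ nStar n × T n d v)
  to simplicial with g ≟ 2
  ... | yes g≡2 = inj₁ (proj₁ vertex , proj₁ (proj₂ vertex) , g≡2)
  ... | no g≢2  = inj₂ (g , Equivalence.from ∣nStar⇔*∣ (simplicial⇒gcd*gcd∣ simplicial g≢2) ,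
                        proj₁ vertex , proj₁ (proj₂ vertex) , refl)
  from : T n 2 v ⊎ Σ ℕ (λ d → d ∣ nStar n × T n d v) → IsSimplicial n v
  from (inj₁ (_ , _ , g≡2))               = gcd≡2⇒simplicial g≡2
  from (inj₂ (d , d∣nStar , _ , _ , g≡d)) =
    gcd*gcd∣⇒simplicial (subst (λ x → x * x ∣ n) (sym g≡d) (Equivalence.to ∣nStar⇔*∣ d∣nStar))
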